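{- Let $C$ be a co-clone over a finite set $D$ with a weak base $\Gamma_w$ and a plain base $\Gamma_p$. If $\Gamma_p\subseteq\langle\Gamma_w\rangle_{\exists!}$, then $C$ is $\exists!$-covered.
   Context: A pp-definition of an $n$-ary relation $R$ over $\Gamma$ is a formula $R(x_1,\dots,x_n)\equiv\exists y_1,\dots,y_m\colon R_1(\mathbf{x}_1)\wedge\dots\wedge R_k(\mathbf{x}_k)$ with $R_j\in\Gamma\cup\{\mathrm{Eq}_D\}$, $\mathrm{Eq}_D=\{(d,d)\mid d\in D\}$, and $\mathbf{x}_j$ tuples of variables among $x_1,\dots,x_n,y_1,\dots,y_m$; it is quantifier-free (qfpp) if $m=0$. $\langle\Gamma\rangle$ and $\langle\Gamma\rangle_{\not\exists}$ denote the sets of pp-definable, resp. qfpp-definable, relations over $\Gamma$. A co-clone is a set of the form $\langle\Gamma\rangle$, and $\Gamma$ is a base of $C$ if $\langle\Gamma\rangle=C$. A base $\Gamma_w$ of $C$ is a weak base if $\langle\Gamma_w\rangle_{\not\exists}\subseteq\langle\Delta\rangle_{\not\exists}$ for every base $\Delta$ of $C$; a base $\Gamma_p$ of $C$ is a plain base if $\langle\Delta\rangle_{\not\exists}\subseteq\langle\Gamma_p\rangle_{\not\exists}$ for every base $\Delta$ of $C$. A upp-definition is a pp-definition where each $y_j$ is uniquely determined by $x_1,\dots,x_n$ (a function of their values in every satisfying assignment of the conjunction); $\langle\Delta\rangle_{\exists!}$ is the set of upp-definable relations. $C$ is $\exists!$-covered if $\langle\Delta\rangle_{\exists!}=C$ for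 every base $\Delta$ of $C$. -}

module Defs where

open import Data.Nat using (ℕ; _+_)
open import Data.Fin using (Fin)
open import Data.Vec using (Vec; []; _∷_; _++_; lookup; map)
open import Data.List using (List; []; _∷_)
open import Data.Unit using (⊤)
open import Data.Product using (Σ; _×_; ∃)
open import Relation.Binary.PropositionalEquality using (_≡_)
open import Function.Bundles using (_⇔_)

-- Throughout, the finite domain D is  Fin d  (any finite set is in bijection
-- with some Fin d).
module _ (d : ℕ) where

  D : Set
  D = Fin d

  Rel : ℕ → Set₁
  Rel n = Vec D n → Set

  EqD : Rel 2
  EqD (a ∷ b ∷ []) = a ≡ b

  Lang : Set₂
  Lang = (n : ℕ) → Rel n → Set₁

  data Atom (Γ : Lang) (v : ℕ) : Set₁ where
    rel : ∀ {k} (R : Rel k) → Γ k R → Vec (Fin v) k → Atom Γ v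
    eq  : Fin v → Fin v → Atom Γ v

  holds : ∀ {Γ v} → Atom Γ v → Vec D v → Set
  holds (rel R _ xs) a = R (map (lookup a) xs)
  holds (eq i j) a = EqD (lookup a i ∷ lookup a j ∷ [])

  -- A pp-formula with n free variables x_1..x_n and m quantified variables
  -- y_1..y_m; variables are Fin (n + m), the first n being the x's.
  record PPFormula (Γ : Lang) (n : ℕ) : Set₁ where
    field
      m     : ℕ
      atoms : List (Atom Γ (n + m))

  open PPFormula public

  AllHold : ∀ {Γ v} → List (Atom Γ v) → Vec D v → Set
  AllHold [] a = ⊤
  AllHold (at ∷ ats) a = holds at a × AllHold ats a

  Sat : ∀ {Γ n} (φ : PPFormula Γ n) → Vec D n → Vec D (m φ) → Set
  Sat φ x y = AllHold (atoms φ) (x ++ y)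

  ⟦_⟧ : ∀ {Γ n} → PPFormula Γ n → Rel n
  ⟦ φ ⟧ x = ∃ λ y → Sat φ x y

  UniqueWitnesses : ∀ {Γ n} → PPFormula Γ n → Set
  UniqueWitnesses φ = ∀ x y y′ → Sat φ x y → Sat φ x y′ → y ≡ y′

  Defines : ∀ {Γ n} → PPFormula Γ n → Rel n → Set
  Defines φ R = ∀ x → R x ⇔ ⟦ φ ⟧ x

  ⟨_⟩ : Lang → Lang
  ⟨ Γ ⟩ n R = Σ (PPFormula Γ n) λ φ → (Defines φ R)

  ⟨_⟩qf : Lang → Lang
  ⟨ Γ ⟩qf n R = Σ (PPFormula Γ n) λ φ → ((m φ ≡ 0) × Defines φ R)

  ⟨_⟩u : Lang → Lang
  ⟨ Γ ⟩u n R = Σ (PPFormula Γ n) λ φ → (UniqueWitnesses φ × Defines φ R)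

  _⊆_ : Lang → Lang → Set₁
  A ⊆ B = ∀ n R → A n R → B n R

  _≐_ : Lang → Lang → Set₁
  A ≐ B = (A ⊆ B) × (B ⊆ A)

  IsCoClone : Lang → Set₂
  IsCoClone C = Σ Lang λ Γ → ⟨ Γ ⟩ ≐ C

  IsBase : Lang → Lang → Set₁
  IsBase Γ C = ⟨ Γ ⟩ ≐ C

  IsWeakBase : Lang → Lang → Set₂
  IsWeakBase Γw C = IsBase Γw C × (∀ Δ → IsBase Δ C → ⟨ Γw ⟩qf ⊆ ⟨ Δ ⟩qf)

  IsPlainBase : Lang → Lang → Set₂
  IsPlainBase Γp C = IsBase Γp C × (∀ Δ → IsBase Δ C → ⟨ Δ ⟩qf ⊆ ⟨ Γp ⟩qf)

  ∃!-Covered : Lang → Set₂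
  ∃!-Covered C = ∀ Δ → IsBase Δ C → ⟨ Δ ⟩u ≐ C

-- upp-definability is transitive: substituting upp-definitions over Δ for the
-- relations of Γ in a upp-formula over Γ yields a upp-formula over Δ, since the
-- fresh witnesses of each substituted atom are determined by the variables of
-- that atom, which the free variables determine in turn. Now let Δ be any base
-- of C. Every R ∈ C is qfpp-definable over C, hence over the plain base Γp;
-- every relation of Γp is upp-definable over Γw by hypothesis; and every
-- relation of Γw is qfpp-definable over Δ because Γw is a weak base. Chaining
-- these definitions puts R in ⟨Δ⟩∃!.

module Submission where

open import Defs
open import Data.Nat using (ℕ; _+_)
open import Data.Fin using (Fin; _↑ˡ_; _↑ʳ_; splitAt)
open import Data.Vec using (Vec; []; _++_; lookup; map; allFin)
import Data.Vec as Vec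
open import Data.Vec.Properties
  using (lookup-splitAt; lookup-++ˡ; lookup-++ʳ; lookup-map; map-∘; map-cong; tabulate-allFin; tabulate∘lookup)
open import Data.List using (List; []; _∷_) renaming (_++_ to _++ᴸ_; map to mapᴸ)
open import Data.Unit using (tt)
open import Data.Product using (_×_; ∃; _,_; proj₁; proj₂)
open import Data.Product.Function.NonDependent.Propositional using (_×-cong_)
open import Data.Product.Function.Dependent.Propositional using (congˡ)
open import Data.Sum using ([_,_]′)
open import Data.Sum.Properties using ([,]-∘; [,]-cong)
open import Function using (_∘_)
open import Function.Bundles using (_⇔_; mk⇔; module Equivalence)
open Equivalence using (to; from)
import Function.Properties.Equivalence as ⇔
open import Function.Related.Propositional using (equivalence; ≡⇒; module EquationalReasoning)
open import Relation.Binary.PropositionalEquality using (_≡_; _≗_; refl; sym; trans; cong; cong₂; module ≡-Reasoning)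

_⊕_ : ∀ {k l w} → (Fin k → Fin w) → (Fin l → Fin w) → Fin (k + l) → Fin w
_⊕_ {k} f g = [ f , g ]′ ∘ splitAt k

omitLast : ∀ n j m → Fin (n + j) → Fin (n + (j + m))
omitLast n j m = (_↑ˡ (j + m)) ⊕ (λ b → n ↑ʳ (b ↑ˡ m))

omitMiddle : ∀ n j m → Fin (n + m) → Fin (n + (j + m))
omitMiddle n j m = (_↑ˡ (j + m)) ⊕ (λ l → n ↑ʳ (j ↑ʳ l))

module _ {a} {A : Set a} where

  lookup-⊕ : ∀ {k l w} {f : Fin k → Fin w} {g : Fin l → Fin w} (z : Vec A w) (x : Vec A k) (y : Vec A l) →
             lookup z ∘ f ≗ lookup x → lookup z ∘ g ≗ lookup y → lookup z ∘ (f ⊕ g) ≗ lookup (x ++ y)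
  lookup-⊕ {k} {f = f} {g} z x y z∘f≗x z∘g≗y i = begin
    lookup z ([ f , g ]′ (splitAt k i))             ≡⟨ [,]-∘ (lookup z) (splitAt k i) ⟩
    [ lookup z ∘ f , lookup z ∘ g ]′ (splitAt k i)  ≡⟨ [,]-cong z∘f≗x z∘g≗y (splitAt k i) ⟩
    [ lookup x , lookup y ]′ (splitAt k i)          ≡⟨ lookup-splitAt k x y i ⟨
    lookup (x ++ y) i                               ∎
    where open ≡-Reasoning

  lookup-omitLast : ∀ {n j m} (x : Vec A n) (y : Vec A j) (z : Vec A m) →
                    lookup (x ++ (y ++ z)) ∘ omitLast n j m ≗ lookup (x ++ y)
  lookup-omitLast x y z = lookup-⊕ (x ++ (y ++ z)) x y (lookup-++ˡ x (y ++ z))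
    (λ b → trans (lookup-++ʳ x (y ++ z) (b ↑ˡ _)) (lookup-++ˡ y z b))

  lookup-omitMiddle : ∀ {n j m} (x : Vec A n) (y : Vec A j) (z : Vec A m) →
                      lookup (x ++ (y ++ z)) ∘ omitMiddle n j m ≗ lookup (x ++ z)
  lookup-omitMiddle {j = j} x y z = lookup-⊕ (x ++ (y ++ z)) x z (lookup-++ˡ x (y ++ z))
    (λ l → trans (lookup-++ʳ x (y ++ z) (j ↑ʳ l)) (lookup-++ʳ y z l))

  ∃-++ : ∀ {m n p} {P : Vec A (m + n) → Set p} → (∃ λ w → P w) ⇔ (∃ λ y → ∃ λ z → P (y ++ z))
  ∃-++ {m} {P = P} = mk⇔ split (λ (y , z , p) → y ++ z , p)
    where
    split : (∃ λ w → P w) → ∃ λ y → ∃ λ z → P (y ++ z)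
    split (w , p) with Vec.splitAt m w
    ... | y , z , refl = y , z , p

  map-lookup-allFin : ∀ {n} (x : Vec A n) → map (lookup x) (allFin n) ≡ x
  map-lookup-allFin x = trans (sym (tabulate-allFin (lookup x))) (tabulate∘lookup x)

  []-unique : (y y′ : Vec A 0) → y ≡ y′
  []-unique [] [] = refl

module _ (d : ℕ) where

  private variable
    Γ Δ : Lang d
    k n v w : ℕ

  rename : (Fin v → Fin w) → Atom d Γ v → Atom d Γ w
  rename ρ (rel R p xs) = rel R p (map ρ xs)
  rename ρ (eq i j)     = eq (ρ i) (ρ j)

  holds-rename : (ρ : Fin v → Fin w) {a : Vec (D d) w} {b : Vec (D d) v} → lookup a ∘ ρ ≗ lookup b →
                 (at : Atom d Γ v) → holds d (rename ρ at) a ≡ holds d at b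
  holds-rename ρ {a} a∘ρ≗b (rel R p xs) = cong R (trans (sym (map-∘ (lookup a) ρ xs)) (map-cong a∘ρ≗b xs))
  holds-rename ρ     a∘ρ≗b (eq i j)     = cong₂ _≡_ (a∘ρ≗b i) (a∘ρ≗b j)

  AllHold-rename : (ρ : Fin v → Fin w) {a : Vec (D d) w} {b : Vec (D d) v} → lookup a ∘ ρ ≗ lookup b →
                   (ats : List (Atom d Γ v)) → AllHold d (mapᴸ (rename ρ) ats) a ≡ AllHold d ats b
  AllHold-rename ρ a∘ρ≗b []         = refl
  AllHold-rename ρ a∘ρ≗b (at ∷ ats) = cong₂ _×_ (holds-rename ρ a∘ρ≗b at) (AllHold-rename ρ a∘ρ≗b ats)

  AllHold-++ : (ats bts : List (Atom d Γ v)) (a : Vec (D d) v) →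
               AllHold d (ats ++ᴸ bts) a ⇔ (AllHold d ats a × AllHold d bts a)
  AllHold-++ []         bts a = mk⇔ (tt ,_) proj₂
  AllHold-++ (at ∷ ats) bts a = ⇔.trans (⇔.refl ×-cong AllHold-++ ats bts a)
    (mk⇔ (λ (h , hs , hs′) → (h , hs) , hs′) (λ ((h , hs) , hs′) → h , hs , hs′))

  quantifierFree : List (Atom d Δ v) → PPFormula d Δ v
  quantifierFree ats = record { m = 0 ; atoms = mapᴸ (rename (_↑ˡ 0)) ats }

  ⟦quantifierFree⟧ : (ats : List (Atom d Δ v)) (x : Vec (D d) v) →
                     ⟦_⟧ d (quantifierFree ats) x ⇔ AllHold d ats x
  ⟦quantifierFree⟧ ats x =
    mk⇔ (λ { ([] , s) → to (Sat-qf []) s }) (λ h → [] , from (Sat-qf []) h)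
    where
    Sat-qf : (y : Vec (D d) 0) → Sat d (quantifierFree ats) x y ⇔ AllHold d ats x
    Sat-qf [] = ≡⇒ (AllHold-rename (_↑ˡ 0) (lookup-++ˡ x []) ats)

  quantifierFree-unique : (ats : List (Atom d Δ v)) → UniqueWitnesses d (quantifierFree ats)
  quantifierFree-unique ats _ y y′ _ _ = []-unique y y′

  atomic : Atom d Δ v → PPFormula d Δ v
  atomic at = quantifierFree (at ∷ [])

  ⟦atomic⟧ : (at : Atom d Δ v) (x : Vec (D d) v) → ⟦_⟧ d (atomic at) x ⇔ holds d at x
  ⟦atomic⟧ at x = ⇔.trans (⟦quantifierFree⟧ (at ∷ []) x) (mk⇔ proj₁ (_, tt))

  module _ (φ ψ : PPFormula d Δ v) where

    conjunction : PPFormula d Δ v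
    conjunction = record
      { m     = m φ + m ψ
      ; atoms = mapᴸ (rename (omitLast v (m φ) (m ψ))) (atoms φ)
             ++ᴸ mapᴸ (rename (omitMiddle v (m φ) (m ψ))) (atoms ψ)
      }

    Sat-conjunction : (x : Vec (D d) v) (y : Vec (D d) (m φ)) (z : Vec (D d) (m ψ)) →
                      Sat d conjunction x (y ++ z) ⇔ (Sat d φ x y × Sat d ψ x z)
    Sat-conjunction x y z = ⇔.trans (AllHold-++ _ _ _) (≡⇒ (cong₂ _×_
      (AllHold-rename (omitLast v (m φ) (m ψ)) (lookup-omitLast x y z) (atoms φ))
      (AllHold-rename (omitMiddle v (m φ) (m ψ)) (lookup-omitMiddle x y z) (atoms ψ))))

    ⟦conjunction⟧ : (x : Vec (D d) v) → ⟦_⟧ d conjunction x ⇔ (⟦_⟧ d φ x × ⟦_⟧ d ψ x)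
    ⟦conjunction⟧ x = begin
      ⟦_⟧ d conjunction x                                ∼⟨ ∃-++ ⟩
      (∃ λ y → ∃ λ z → Sat d conjunction x (y ++ z))    ∼⟨ congˡ (congˡ (Sat-conjunction x _ _)) ⟩
      (∃ λ y → ∃ λ z → Sat d φ x y × Sat d ψ x z)       ∼⟨ mk⇔ (λ (y , z , s , t) → (y , s) , (z , t))
                                                               (λ ((y , s) , (z , t)) → y , z , s , t) ⟩
      (⟦_⟧ d φ x × ⟦_⟧ d ψ x)                           ∎
      where open EquationalReasoning {k = equivalence}

    conjunction-unique : UniqueWitnesses d φ → UniqueWitnesses d ψ → UniqueWitnesses d conjunction
    conjunction-unique φ-unique ψ-unique x w w′ s s′ with Vec.splitAt (m φ) w | Vec.splitAt (m φ) w′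
    ... | y , z , refl | y′ , z′ , refl =
      cong₂ _++_ (φ-unique x y y′ (proj₁ t) (proj₁ t′)) (ψ-unique x z z′ (proj₂ t) (proj₂ t′))
      where
      t  = to (Sat-conjunction x y z) s
      t′ = to (Sat-conjunction x y′ z′) s′

  module _ (ψ : PPFormula d Δ k) (xs : Vec (Fin v) k) where

    private
      ρ : Fin (k + m ψ) → Fin (v + m ψ)
      ρ = (λ j → lookup xs j ↑ˡ m ψ) ⊕ (v ↑ʳ_)

    instantiate : PPFormula d Δ v
    instantiate = record { m = m ψ ; atoms = mapᴸ (rename ρ) (atoms ψ) }

    Sat-instantiate : (x : Vec (D d) v) (y : Vec (D d) (m ψ)) →
                      Sat d instantiate x y ⇔ Sat d ψ (map (lookup x) xs) y
    Sat-instantiate x y = ≡⇒ (AllHold-rename ρ (lookup-⊕ (x ++ y) (map (lookup x) xs) y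
      (λ j → trans (lookup-++ˡ x y (lookup xs j)) (sym (lookup-map j (lookup x) xs)))
      (lookup-++ʳ x y)) (atoms ψ))

    ⟦instantiate⟧ : (x : Vec (D d) v) → ⟦_⟧ d instantiate x ⇔ ⟦_⟧ d ψ (map (lookup x) xs)
    ⟦instantiate⟧ x = congˡ (Sat-instantiate x _)

    instantiate-unique : UniqueWitnesses d ψ → UniqueWitnesses d instantiate
    instantiate-unique ψ-unique x y y′ s s′ =
      ψ-unique _ y y′ (to (Sat-instantiate x y) s) (to (Sat-instantiate x y′) s′)

  module _ {j} (ψ : PPFormula d Δ (n + j)) where

    private
      ρ : Fin ((n + j) + m ψ) → Fin (n + (j + m ψ))
      ρ = omitLast n j (m ψ) ⊕ (λ l → n ↑ʳ (j ↑ʳ l))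

    project : PPFormula d Δ n
    project = record { m = j + m ψ ; atoms = mapᴸ (rename ρ) (atoms ψ) }

    Sat-project : (x : Vec (D d) n) (y : Vec (D d) j) (z : Vec (D d) (m ψ)) →
                  Sat d project x (y ++ z) ⇔ Sat d ψ (x ++ y) z
    Sat-project x y z = ≡⇒ (AllHold-rename ρ (lookup-⊕ (x ++ (y ++ z)) (x ++ y) z
      (lookup-omitLast x y z)
      (λ l → trans (lookup-++ʳ x (y ++ z) (j ↑ʳ l)) (lookup-++ʳ y z l))) (atoms ψ))

    ⟦project⟧ : (x : Vec (D d) n) → ⟦_⟧ d project x ⇔ (∃ λ y → ⟦_⟧ d ψ (x ++ y))
    ⟦project⟧ x = ⇔.trans ∃-++ (congˡ (congˡ (Sat-project x _ _)))

    project-unique : UniqueWitnesses d ψ → (∀ x y y′ → ⟦_⟧ d ψ (x ++ y) → ⟦_⟧ d ψ (x ++ y′) → y ≡ y′) →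
                     UniqueWitnesses d project
    project-unique ψ-unique projection-unique x w w′ s s′ with Vec.splitAt j w | Vec.splitAt j w′
    ... | y , z , refl | y′ , z′ , refl =
      same-witnesses (projection-unique x y y′ (z , t) (z′ , t′)) t′
      where
      t  = to (Sat-project x y z) s
      t′ = to (Sat-project x y′ z′) s′

      same-witnesses : ∀ {y″ z″} → y ≡ y″ → Sat d ψ (x ++ y″) z″ → y ++ z ≡ y″ ++ z″
      same-witnesses refl t″ = cong (y ++_) (ψ-unique (x ++ y) z _ t t″)

  module Translation (def : ∀ k R → Γ k R → PPFormula d Δ k) where

    translateAtom : Atom d Γ v → PPFormula d Δ v
    translateAtom (rel R p xs) = instantiate (def _ R p) xs
    translateAtom (eq i j)     = atomic (eq i j)

    translateAtoms : List (Atom d Γ v) → PPFormula d Δ v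
    translateAtoms []         = quantifierFree []
    translateAtoms (at ∷ ats) = conjunction (translateAtom at) (translateAtoms ats)

    translate : PPFormula d Γ n → PPFormula d Δ n
    translate φ = project (translateAtoms (atoms φ))

    module _ (def-defines : ∀ k R p → Defines d (def k R p) R) where

      ⟦translateAtom⟧ : (at : Atom d Γ v) (a : Vec (D d) v) → ⟦_⟧ d (translateAtom at) a ⇔ holds d at a
      ⟦translateAtom⟧ (rel R p xs) a = ⇔.trans (⟦instantiate⟧ (def _ R p) xs a) (⇔.sym (def-defines _ R p _))
      ⟦translateAtom⟧ (eq i j)     a = ⟦atomic⟧ {Δ = Δ} (eq i j) a

      ⟦translateAtoms⟧ : (ats : List (Atom d Γ v)) (a : Vec (D d) v) →
                         ⟦_⟧ d (translateAtoms ats) a ⇔ AllHold d ats a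
      ⟦translateAtoms⟧ []         a = ⟦quantifierFree⟧ {Δ = Δ} [] a
      ⟦translateAtoms⟧ (at ∷ ats) a =
        ⇔.trans (⟦conjunction⟧ _ _ a) (⟦translateAtom⟧ at a ×-cong ⟦translateAtoms⟧ ats a)

      ⟦translate⟧ : (φ : PPFormula d Γ n) (x : Vec (D d) n) → ⟦_⟧ d (translate φ) x ⇔ ⟦_⟧ d φ x
      ⟦translate⟧ φ x = ⇔.trans (⟦project⟧ _ x) (congˡ (⟦translateAtoms⟧ (atoms φ) _))

      translate-defines : (φ : PPFormula d Γ n) {R : Rel d n} → Defines d φ R → Defines d (translate φ) R
      translate-defines φ φ-defines x = ⇔.trans (φ-defines x) (⇔.sym (⟦translate⟧ φ x))

      module _ (def-unique : ∀ k R p → UniqueWitnesses d (def k R p)) where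

        translateAtom-unique : (at : Atom d Γ v) → UniqueWitnesses d (translateAtom at)
        translateAtom-unique (rel R p xs) = instantiate-unique (def _ R p) xs (def-unique _ R p)
        translateAtom-unique (eq i j)     = quantifierFree-unique {Δ = Δ} (eq i j ∷ [])

        translateAtoms-unique : (ats : List (Atom d Γ v)) → UniqueWitnesses d (translateAtoms ats)
        translateAtoms-unique []         = quantifierFree-unique {Δ = Δ} []
        translateAtoms-unique (at ∷ ats) =
          conjunction-unique _ _ (translateAtom-unique at) (translateAtoms-unique ats)

        translate-unique : (φ : PPFormula d Γ n) → UniqueWitnesses d φ → UniqueWitnesses d (translate φ)
        translate-unique φ φ-unique = project-unique _ (translateAtoms-unique (atoms φ))
          λ x y y′ t t′ → φ-unique x y y′ (to (⟦translateAtoms⟧ (atoms φ) _) t)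
                                          (to (⟦translateAtoms⟧ (atoms φ) _) t′)

  ⊆-trans : {A B C : Lang d} → _⊆_ d A B → _⊆_ d B C → _⊆_ d A C
  ⊆-trans A⊆B B⊆C n R = B⊆C n R ∘ A⊆B n R

  ⊆⟨⟩qf : _⊆_ d Γ (⟨_⟩qf d Γ)
  ⊆⟨⟩qf {Γ} n R p = atomic (rel R p (allFin n)) , refl , λ x →
    ⇔.sym (⇔.trans (⟦atomic⟧ {Δ = Γ} (rel R p (allFin n)) x) (≡⇒ (cong R (map-lookup-allFin x))))

  ⟨⟩qf⊆⟨⟩u : _⊆_ d (⟨_⟩qf d Γ) (⟨_⟩u d Γ)
  ⟨⟩qf⊆⟨⟩u n R (φ , m≡0 , φ-defines) = φ , unique m≡0 , φ-defines
    where
    unique : m φ ≡ 0 → UniqueWitnesses d φ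
    unique refl _ y y′ _ _ = []-unique y y′

  ⟨⟩u⊆⟨⟩ : _⊆_ d (⟨_⟩u d Γ) (⟨_⟩ d Γ)
  ⟨⟩u⊆⟨⟩ n R (φ , _ , φ-defines) = φ , φ-defines

  ⟨⟩-transitive : _⊆_ d Γ (⟨_⟩ d Δ) → _⊆_ d (⟨_⟩ d Γ) (⟨_⟩ d Δ)
  ⟨⟩-transitive Γ⊆⟨Δ⟩ n R (φ , φ-defines) = translate φ , translate-defines def-defines φ φ-defines
    where
    open Translation (λ k R p → proj₁ (Γ⊆⟨Δ⟩ k R p))
    def-defines = λ k R p → proj₂ (Γ⊆⟨Δ⟩ k R p)

  ⟨⟩u-transitive : _⊆_ d Γ (⟨_⟩u d Δ) → _⊆_ d (⟨_⟩u d Γ) (⟨_⟩u d Δ)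
  ⟨⟩u-transitive Γ⊆⟨Δ⟩u n R (φ , φ-unique , φ-defines) =
    translate φ , translate-unique def-defines def-unique φ φ-unique , translate-defines def-defines φ φ-defines
    where
    open Translation (λ k R p → proj₁ (Γ⊆⟨Δ⟩u k R p))
    def-unique  = λ k R p → proj₁ (proj₂ (Γ⊆⟨Δ⟩u k R p))
    def-defines = λ k R p → proj₂ (proj₂ (Γ⊆⟨Δ⟩u k R p))

  IsBase-self : {C : Lang d} → IsBase d Γ C → IsBase d C C
  IsBase-self (⟨Γ⟩⊆C , C⊆⟨Γ⟩) =
    ⊆-trans (⟨⟩-transitive C⊆⟨Γ⟩) ⟨Γ⟩⊆C , ⊆-trans ⊆⟨⟩qf (⊆-trans ⟨⟩qf⊆⟨⟩u ⟨⟩u⊆⟨⟩)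

  IsPlainBase⇒⊆⟨⟩qf : {C : Lang d} → IsPlainBase d Γ C → _⊆_ d C (⟨_⟩qf d Γ)
  IsPlainBase⇒⊆⟨⟩qf (Γ-base , Γ-plain) = ⊆-trans ⊆⟨⟩qf (Γ-plain _ (IsBase-self Γ-base))

  IsWeakBase⇒⊆⟨⟩qf : {C : Lang d} → IsWeakBase d Γ C → IsBase d Δ C → _⊆_ d Γ (⟨_⟩qf d Δ)
  IsWeakBase⇒⊆⟨⟩qf (_ , Γ-weak) Δ-base = ⊆-trans ⊆⟨⟩qf (Γ-weak _ Δ-base)

lemma11 : (d : ℕ) (C Γw Γp : Lang d) → IsCoClone d C
    → IsWeakBase d Γw C → IsPlainBase d Γp C
    → _⊆_ d Γp (⟨_⟩u d Γw)
    → ∃!-Covered d C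
lemma11 d C Γw Γp _ Γw-weak Γp-plain Γp⊆⟨Γw⟩u Δ Δ-base = ⟨Δ⟩u⊆C , C⊆⟨Δ⟩u
  where
  ⟨Δ⟩u⊆C : _⊆_ d (⟨_⟩u d Δ) C
  ⟨Δ⟩u⊆C = ⊆-trans d (⟨⟩u⊆⟨⟩ d) (proj₁ Δ-base)

  Γw⊆⟨Δ⟩u : _⊆_ d Γw (⟨_⟩u d Δ)
  Γw⊆⟨Δ⟩u = ⊆-trans d (IsWeakBase⇒⊆⟨⟩qf d Γw-weak Δ-base) (⟨⟩qf⊆⟨⟩u d)

  C⊆⟨Δ⟩u : _⊆_ d C (⟨_⟩u d Δ)
  C⊆⟨Δ⟩u = ⊆-trans d (IsPlainBase⇒⊆⟨⟩qf d Γp-plain)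
          (⊆-trans d (⟨⟩qf⊆⟨⟩u d)
          (⊆-trans d (⟨⟩u-transitive d Γp⊆⟨Γw⟩u)
                     (⟨⟩u-transitive d Γw⊆⟨Δ⟩u)))
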